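{- Let $\mathbf{F}_q$ be a finite field of characteristic $p$. Set $d_0=-1$ and for $1\le k\le q-1$ let $d_k=M(k,1,\mathbf{F}_q^*)-M(k,0,\mathbf{F}_q^*)$. Then $d_1=1$, and for $2\le k\le q-1$: $d_k=-k\,d_{k-1}$ if $p\nmid k$, and $d_k=(q-k)\,d_{k-1}$ if $p\mid k$.
   Context: For $D\subseteq\mathbf{F}_q$, an integer $k\ge1$ and $b\in\mathbf{F}_q$, $M(k,b,D)$ is the number of ordered $k$-tuples $(x_1,\dots,x_k)$ of pairwise distinct elements of $D$ with $x_1+\cdots+x_k=b$. $\mathbf{F}_q^*=\mathbf{F}_q\setminus\{0\}$. -}

module Defs where

open import Level using (0ℓ)
open import Data.Nat as ℕ using (ℕ; zero; suc)
open import Data.Integer as ℤ using (ℤ)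
open import Data.Fin using (Fin)
open import Data.Nat.Primality using (Prime)
open import Data.List as List using (List; []; _∷_)
open import Data.List.Relation.Unary.AllPairs using (allPairs?)
open import Data.Product using (_×_; ∃)
open import Relation.Binary.PropositionalEquality using (_≡_; _≢_)
open import Relation.Binary.Definitions using (DecidableEquality)
open import Relation.Nullary using (Dec; ¬_)
open import Relation.Nullary.Decidable using (_×-dec_; ¬?)
open import Algebra.Core using (Op₁; Op₂)
open import Algebra.Structures using (IsCommutativeRing)
open import Function.Definitions using (Bijective)

record FiniteField : Set₁ where
  field
    Carrier : Set
    _+_ _*_ : Op₂ Carrier
    -_      : Op₁ Carrier
    0# 1#   : Carrier
    isCommutativeRing : IsCommutativeRing _≡_ _+_ _*_ -_ 0# 1#
    0≢1     : 0# ≢ 1#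
    inverse : ∀ x → x ≢ 0# → ∃ λ y → x * y ≡ 1#
    _≟_     : DecidableEquality Carrier
    q       : ℕ
    enum    : Fin q → Carrier
    enum-bij : Bijective _≡_ _≡_ enum

  natCast : ℕ → Carrier
  natCast zero    = 0#
  natCast (suc n) = 1# + natCast n

  elements : List Carrier
  elements = List.map enum (List.allFin q)

  nonzero? : (x : Carrier) → Dec (x ≢ 0#)
  nonzero? x = ¬? (x ≟ 0#)

  tuples : List Carrier → ℕ → List (List Carrier)
  tuples D zero    = [] ∷ []
  tuples D (suc k) = List.concatMap (λ x → List.map (x ∷_) (tuples D k)) D

  sumF : List Carrier → Carrier
  sumF = List.foldr _+_ 0#

  M : ∀ {P : Carrier → Set} → ((x : Carrier) → Dec (P x)) → ℕ → Carrier → ℕ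
  M P? k b = List.length
    (List.filter (λ xs → allPairs? (λ x y → ¬? (x ≟ y)) xs ×-dec (sumF xs ≟ b))
                 (tuples (List.filter P? elements) k))

  d : ℕ → ℤ
  d zero    = ℤ.-[1+ 0 ]
  d (suc k) = ℤ.+ (M nonzero? (suc k) 1#) ℤ.- ℤ.+ (M nonzero? (suc k) 0#)

  IsCharacteristic : ℕ → Set
  IsCharacteristic p = Prime p × natCast p ≡ 0#

{-# OPTIONS --safe #-}

-- Let N(k, b) count the distinct k-tuples over all of F_q with sum b, and M_k(b) = M(k, b, F_q^*).
-- Deleting the entry 0 (if present) gives N(k, b) = M_k(b) + k M_{k-1}(b). On the other hand, a
-- distinct k-tuple with first entry c is (c, y₁ + c, …, y_{k-1} + c) for a unique distinct tuple y
-- of nonzero elements, and its sum is Σ y + k c. If k ≠ 0 in F_q exactly one c gives the sum b,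
-- so N(k, b) does not depend on b; if k = 0 in F_q the sum does not depend on c, so
-- N(k, b) = q M_{k-1}(b). Subtracting the cases b = 0 from b = 1 gives the two recurrences for d_k,
-- and k = 0 in F_q exactly when p ∣ k.

module Submission where

open import Defs
open import Level using (0ℓ)
open import Algebra.Bundles using (CommutativeRing)
open import Data.Bool using (Bool; true; false; _∧_; if_then_else_)
open import Data.Empty using (⊥-elim)
open import Data.Integer as ℤ using (ℤ)
open import Data.Integer.Properties using (pos-+; pos-*)
open import Data.Integer.Tactic.RingSolver using (solve-∀)
open import Data.List using (List; []; _∷_; _++_; map; filter; length; concatMap; allFin)
import Data.List.Properties as List
open import Data.List.Membership.Propositional using (_∈_; _∉_; find)
open import Data.List.Membership.Propositional.Properties using (∈-map⁺; ∈-map⁻; ∈-filter⁺; ∈-filter⁻; ∈-allFin)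
open import Data.List.Membership.Propositional.Properties.WithK using (unique∧set⇒bag)
open import Data.List.Relation.Binary.BagAndSetEquality using (∼bag⇒↭)
open import Data.List.Relation.Binary.Permutation.Propositional using (_↭_; ↭-refl; ↭-prep; ↭-swap; ↭-trans; ↭-sym)
open import Data.List.Relation.Binary.Permutation.Propositional.Properties using (All-resp-↭)
import Data.List.Relation.Binary.Permutation.Propositional.Properties as ↭
open import Data.List.Relation.Unary.All as All using (All; []; _∷_)
import Data.List.Relation.Unary.All.Properties as All
open import Data.List.Relation.Unary.AllPairs using (allPairs?; []; _∷_)
open import Data.List.Relation.Unary.Any using (here; there)
import Data.List.Relation.Unary.Any.Properties as Any
open import Data.List.Relation.Unary.Unique.Propositional using (Unique)
import Data.List.Relation.Unary.Unique.Propositional.Properties as Unique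
open import Data.Nat as ℕ using (ℕ; zero; suc; _∸_; _≤_)
import Data.Nat.Properties as ℕ
open import Algebra.Properties.CommutativeSemigroup ℕ.+-commutativeSemigroup using (interchange; x∙yz≈y∙xz)
open import Data.Nat.Coprimality using (Coprime; coprime-Bézout)
open import Data.Nat.Divisibility using (_∣_; divides)
open import Data.Nat.GCD using (module Bézout)
open import Data.Nat.ListAction using (sum)
open import Data.Nat.ListAction.Properties using (sum-++; sum-↭)
open import Data.Nat.Primality using (prime⇒irreducible)
open import Data.Product using (_×_; _,_; proj₁; proj₂; ∃)
open import Data.Sum using (inj₁; inj₂)
open import Function.Base using (id)
open import Function.Bundles using (mk⇔)
open import Function.Definitions using (Injective)
open import Relation.Binary.Definitions using (DecidableEquality)
open import Relation.Binary.PropositionalEquality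
open import Relation.Nullary using (Dec; yes; no; does; ¬_)
open import Relation.Nullary.Decidable using (¬?; dec-true; dec-false; does-⇔)
open import Relation.Unary using (Pred; Decidable)

infixl 5 _when_

_when_ : ℕ → Bool → ℕ
n when b = if b then n else 0

𝟙 : Bool → ℕ
𝟙 b = 1 when b

when-∧ : ∀ n a b → n when (a ∧ b) ≡ n when b when a
when-∧ n true  b = refl
when-∧ n false b = refl

when-comm : ∀ n a b → n when a when b ≡ n when b when a
when-comm n true  b     = refl
when-comm n false true  = refl
when-comm n false false = refl

0-when : ∀ b → 0 when b ≡ 0
0-when true  = refl
0-when false = refl

*-when : ∀ m n b → m ℕ.* n when b ≡ m ℕ.* (n when b)
*-when m n true  = refl
*-when m n false = sym (ℕ.*-zeroʳ m)

module _ {A : Set} where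

  ∑ : List A → (A → ℕ) → ℕ
  ∑ xs f = sum (map f xs)

  ∑-cong : ∀ xs {f g : A → ℕ} → (∀ {x} → x ∈ xs → f x ≡ g x) → ∑ xs f ≡ ∑ xs g
  ∑-cong []       h = refl
  ∑-cong (x ∷ xs) h = cong₂ ℕ._+_ (h (here refl)) (∑-cong xs (λ x∈ → h (there x∈)))

  ∑-zero : ∀ xs → ∑ xs (λ _ → 0) ≡ 0
  ∑-zero []       = refl
  ∑-zero (x ∷ xs) = ∑-zero xs

  ∑-const : ∀ xs m → ∑ xs (λ _ → m) ≡ length xs ℕ.* m
  ∑-const []       m = refl
  ∑-const (x ∷ xs) m = cong (m ℕ.+_) (∑-const xs m)

  ∑-+ : ∀ xs (f g : A → ℕ) → ∑ xs (λ x → f x ℕ.+ g x) ≡ ∑ xs f ℕ.+ ∑ xs g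
  ∑-+ []       f g = refl
  ∑-+ (x ∷ xs) f g = begin
    f x ℕ.+ g x ℕ.+ ∑ xs (λ x → f x ℕ.+ g x) ≡⟨ cong (f x ℕ.+ g x ℕ.+_) (∑-+ xs f g) ⟩
    f x ℕ.+ g x ℕ.+ (∑ xs f ℕ.+ ∑ xs g)       ≡⟨ interchange (f x) (g x) (∑ xs f) (∑ xs g) ⟩
    f x ℕ.+ ∑ xs f ℕ.+ (g x ℕ.+ ∑ xs g)       ∎
    where open ≡-Reasoning

  *-∑ : ∀ xs m (f : A → ℕ) → m ℕ.* ∑ xs f ≡ ∑ xs (λ x → m ℕ.* f x)
  *-∑ []       m f = ℕ.*-zeroʳ m
  *-∑ (x ∷ xs) m f = trans (ℕ.*-distribˡ-+ m (f x) (∑ xs f)) (cong (m ℕ.* f x ℕ.+_) (*-∑ xs m f))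

  ∑-when : ∀ xs (f : A → ℕ) b → ∑ xs f when b ≡ ∑ xs (λ x → f x when b)
  ∑-when xs f true  = refl
  ∑-when xs f false = sym (∑-zero xs)

  ∑-↭ : ∀ {xs ys} (f : A → ℕ) → xs ↭ ys → ∑ xs f ≡ ∑ ys f
  ∑-↭ f p = sum-↭ (↭.map⁺ f p)

  ∑-supported : ∀ {xs x₀} (f : A → ℕ) → Unique xs → x₀ ∈ xs → (∀ {x} → x ≢ x₀ → f x ≡ 0) →
    ∑ xs f ≡ f x₀
  ∑-supported {_ ∷ xs} f (x₀∉xs ∷ _) (here refl) vanish =
    trans (cong (f _ ℕ.+_) (trans (∑-cong xs λ x∈ → vanish λ { refl → All.lookup x₀∉xs x∈ refl })
                                  (∑-zero xs)))
          (ℕ.+-identityʳ _)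
  ∑-supported {_ ∷ xs} f (y∉xs ∷ u) (there x₀∈) vanish =
    cong₂ ℕ._+_ (vanish λ { refl → All.lookup y∉xs x₀∈ refl }) (∑-supported f u x₀∈ vanish)

  length-filter : ∀ {p} {P : Pred A p} (P? : Decidable P) xs → length (filter P? xs) ≡ ∑ xs (λ x → 𝟙 (does (P? x)))
  length-filter P? []       = refl
  length-filter P? (x ∷ xs) with does (P? x)
  ... | true  = cong suc (length-filter P? xs)
  ... | false = length-filter P? xs

module _ {A B : Set} where

  ∑-map : ∀ (g : A → B) xs (f : B → ℕ) → ∑ (map g xs) f ≡ ∑ xs (λ x → f (g x))
  ∑-map g xs f = cong sum (sym (List.map-∘ xs))

  ∑-concatMap : ∀ (h : A → List B) xs (f : B → ℕ) → ∑ (concatMap h xs) f ≡ ∑ xs (λ x → ∑ (h x) f)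
  ∑-concatMap h []       f = refl
  ∑-concatMap h (x ∷ xs) f = begin
    sum (map f (h x ++ concatMap h xs))          ≡⟨ cong sum (List.map-++ f (h x) (concatMap h xs)) ⟩
    sum (map f (h x) ++ map f (concatMap h xs))  ≡⟨ sum-++ (map f (h x)) _ ⟩
    ∑ (h x) f ℕ.+ ∑ (concatMap h xs) f           ≡⟨ cong (∑ (h x) f ℕ.+_) (∑-concatMap h xs f) ⟩
    ∑ (h x) f ℕ.+ ∑ xs (λ x → ∑ (h x) f)         ∎
    where open ≡-Reasoning

  ∑-comm : ∀ xs ys (f : A → B → ℕ) → ∑ xs (λ x → ∑ ys (f x)) ≡ ∑ ys (λ y → ∑ xs (λ x → f x y))
  ∑-comm []       ys f = sym (∑-zero ys)
  ∑-comm (x ∷ xs) ys f = trans (cong (∑ ys (f x) ℕ.+_) (∑-comm xs ys f))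
                               (sym (∑-+ ys (f x) (λ y → ∑ xs (λ x → f x y))))

module _ where

  open import Data.Integer using (+_; _+_; _-_; _*_; -_)

  pos-+-* : ∀ a k x → + (a ℕ.+ k ℕ.* x) ≡ + a + + k * + x
  pos-+-* a k x = trans (pos-+ a (k ℕ.* x)) (cong (_+_ (+ a)) (pos-* k x))

  a-c≡-k[x-y] : ∀ a c k x y → a ℕ.+ k ℕ.* x ≡ c ℕ.+ k ℕ.* y → + a - + c ≡ - + k * (+ x - + y)
  a-c≡-k[x-y] a c k x y eq = begin
    + a - + c
      ≡⟨ regroup (+ a) (+ c) (+ k) (+ x) (+ y) ⟩
    (+ a + + k * + x) - (+ c + + k * + y) - + k * (+ x - + y)
      ≡⟨ cong (λ t → t - (+ c + + k * + y) - + k * (+ x - + y))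
              (trans (sym (pos-+-* a k x)) (trans (cong +_ eq) (pos-+-* c k y))) ⟩
    (+ c + + k * + y) - (+ c + + k * + y) - + k * (+ x - + y)
      ≡⟨ cancel (+ c + + k * + y) (+ k) (+ x - + y) ⟩
    - + k * (+ x - + y) ∎
    where
    open ≡-Reasoning
    regroup : ∀ A C K X Y → A - C ≡ (A + K * X) - (C + K * Y) - K * (X - Y)
    regroup = solve-∀
    cancel : ∀ U K V → U - U - K * V ≡ - K * V
    cancel = solve-∀

  a-c≡[q-k][x-y] : ∀ a c k x y q → a ℕ.+ k ℕ.* x ≡ q ℕ.* x → c ℕ.+ k ℕ.* y ≡ q ℕ.* y →
    + a - + c ≡ (+ q - + k) * (+ x - + y)
  a-c≡[q-k][x-y] a c k x y q eqx eqy = begin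
    + a - + c
      ≡⟨ regroup (+ a) (+ c) (+ k) (+ x) (+ y) (+ q) ⟩
    ((+ a + + k * + x) - + q * + x) - ((+ c + + k * + y) - + q * + y) + (+ q - + k) * (+ x - + y)
      ≡⟨ cong₂ (λ s t → (s - + q * + x) - (t - + q * + y) + (+ q - + k) * (+ x - + y))
               (trans (sym (pos-+-* a k x)) (trans (cong +_ eqx) (pos-* q x)))
               (trans (sym (pos-+-* c k y)) (trans (cong +_ eqy) (pos-* q y))) ⟩
    (+ q * + x - + q * + x) - (+ q * + y - + q * + y) + (+ q - + k) * (+ x - + y)
      ≡⟨ cancel (+ q * + x) (+ q * + y) ((+ q - + k) * (+ x - + y)) ⟩
    (+ q - + k) * (+ x - + y) ∎
    where
    open ≡-Reasoning
    regroup : ∀ A C K X Y Q → A - C ≡ ((A + K * X) - Q * X) - ((C + K * Y) - Q * Y) + (Q - K) * (X - Y)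
    regroup = solve-∀
    cancel : ∀ U V W → (U - U) - (V - V) + W ≡ W
    cancel = solve-∀

module DistinctTuples {A : Set} (_≟_ : DecidableEquality A) where

  tuples : List A → ℕ → List (List A)
  tuples D zero    = [] ∷ []
  tuples D (suc n) = concatMap (λ x → map (x ∷_) (tuples D n)) D

  ∈-tuples⁻ : ∀ {D} n {xs} → xs ∈ tuples D n → All (_∈ D) xs × length xs ≡ n
  ∈-tuples⁻ zero (here refl) = [] , refl
  ∈-tuples⁻ {D} (suc n) xs∈
    with x , x∈D , xs∈′ ← find (Any.concatMap⁻ (λ x → map (x ∷_) (tuples D n)) {xs = D} xs∈)
    with ys , ys∈ , refl ← ∈-map⁻ (x ∷_) xs∈′
    = let ys∈D , len = ∈-tuples⁻ n ys∈ in x∈D ∷ ys∈D , cong suc len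

  _≢?_ : ∀ x y → Dec (x ≢ y)
  x ≢? y = ¬? (x ≟ y)

  distinct? : List A → Bool
  distinct? xs = does (allPairs? _≢?_ xs)

  fresh? : A → List A → Bool
  fresh? x ys = does (All.all? (x ≢?_) ys)

  ∑-distinct : List A → ℕ → (List A → ℕ) → ℕ
  ∑-distinct D n g = ∑ (tuples D n) (λ xs → g xs when distinct? xs)

  startingWith : A → (List A → ℕ) → List A → ℕ
  startingWith x g ys = g (x ∷ ys) when fresh? x ys

  ∑-distinct-suc : ∀ D n (g : List A → ℕ) →
    ∑-distinct D (suc n) g ≡ ∑ D (λ x → ∑-distinct D n (startingWith x g))
  ∑-distinct-suc D n g = begin
    ∑ (concatMap (λ x → map (x ∷_) (tuples D n)) D) G
      ≡⟨ ∑-concatMap (λ x → map (x ∷_) (tuples D n)) D G ⟩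
    ∑ D (λ x → ∑ (map (x ∷_) (tuples D n)) G)
      ≡⟨ ∑-cong D (λ {x} _ → trans (∑-map (x ∷_) (tuples D n) G) (∑-cong (tuples D n) λ {ys} _ →
           trans (when-∧ (g (x ∷ ys)) (fresh? x ys) (distinct? ys))
                 (when-comm (g (x ∷ ys)) (distinct? ys) (fresh? x ys)))) ⟩
    ∑ D (λ x → ∑-distinct D n (startingWith x g)) ∎
    where
    open ≡-Reasoning
    G : List A → ℕ
    G xs = g xs when distinct? xs

  ∑-distinct-cong : ∀ D n {f g : List A → ℕ} → (∀ {xs} → All (_∈ D) xs → length xs ≡ n → f xs ≡ g xs) →
    ∑-distinct D n f ≡ ∑-distinct D n g
  ∑-distinct-cong D n eq = ∑-cong (tuples D n) λ {xs} xs∈ →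
    let xs∈D , len = ∈-tuples⁻ n xs∈ in cong (_when distinct? xs) (eq xs∈D len)

  ∑-distinct-zero : ∀ D n → ∑-distinct D n (λ _ → 0) ≡ 0
  ∑-distinct-zero D n = trans (∑-cong (tuples D n) λ {xs} _ → 0-when (distinct? xs)) (∑-zero (tuples D n))

  *-∑-distinct : ∀ D n m (g : List A → ℕ) → m ℕ.* ∑-distinct D n g ≡ ∑-distinct D n (λ xs → m ℕ.* g xs)
  *-∑-distinct D n m g = trans (*-∑ (tuples D n) m _)
    (∑-cong (tuples D n) λ {xs} _ → sym (*-when m (g xs) (distinct? xs)))

  ∑-distinct-∑ : ∀ {B : Set} D n (L : List B) (G : B → List A → ℕ) →
    ∑-distinct D n (λ xs → ∑ L (λ c → G c xs)) ≡ ∑ L (λ c → ∑-distinct D n (G c))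
  ∑-distinct-∑ D n L G = trans (∑-cong (tuples D n) λ {xs} _ → ∑-when L (λ c → G c xs) (distinct? xs))
                               (∑-comm (tuples D n) L (λ xs c → G c xs when distinct? xs))

  ∑-distinct-↭ : ∀ {D D′} → D ↭ D′ → ∀ n (g : List A → ℕ) → ∑-distinct D n g ≡ ∑-distinct D′ n g
  ∑-distinct-↭ D↭D′ zero    g = refl
  ∑-distinct-↭ {D} {D′} D↭D′ (suc n) g = begin
    ∑-distinct D (suc n) g
      ≡⟨ ∑-distinct-suc D n g ⟩
    ∑ D (λ x → ∑-distinct D n (startingWith x g))
      ≡⟨ ∑-cong D (λ {x} _ → ∑-distinct-↭ D↭D′ n (startingWith x g)) ⟩
    ∑ D (λ x → ∑-distinct D′ n (startingWith x g))
      ≡⟨ ∑-↭ (λ x → ∑-distinct D′ n (startingWith x g)) D↭D′ ⟩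
    ∑ D′ (λ x → ∑-distinct D′ n (startingWith x g))
      ≡⟨ ∑-distinct-suc D′ n g ⟨
    ∑-distinct D′ (suc n) g ∎
    where open ≡-Reasoning

  fresh?-↭ : ∀ x {ys ys′} → ys ↭ ys′ → fresh? x ys ≡ fresh? x ys′
  fresh?-↭ x {ys} {ys′} p =
    does-⇔ (mk⇔ (All-resp-↭ p) (All-resp-↭ (↭-sym p))) (All.all? (x ≢?_) ys) (All.all? (x ≢?_) ys′)

  fresh?-∉ : ∀ {z D} {ys} → z ∉ D → All (_∈ D) ys → fresh? z ys ≡ true
  fresh?-∉ {z} {D} {ys} z∉D ys∈D = dec-true (All.all? (z ≢?_) ys) (All.map (λ { y∈D refl → z∉D y∈D }) ys∈D)

  fresh?-map : ∀ {τ : A → A} → Injective _≡_ _≡_ τ → ∀ y ys → fresh? (τ y) (map τ ys) ≡ fresh? y ys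
  fresh?-map {τ} τ-inj y ys = does-⇔ (mk⇔
    (λ τy∉ → All.map (λ τy≢ y≡ → τy≢ (cong τ y≡)) (All.map⁻ τy∉))
    (λ y∉ → All.map⁺ (All.map (λ y≢ τy≡ → y≢ (τ-inj τy≡)) y∉)))
    (All.all? (τ y ≢?_) (map τ ys)) (All.all? (y ≢?_) ys)

  insertAt : ℕ → A → List A → List A
  insertAt zero    z ys       = z ∷ ys
  insertAt (suc i) z []       = z ∷ []
  insertAt (suc i) z (y ∷ ys) = y ∷ insertAt i z ys

  insertAt-↭ : ∀ i z ys → insertAt i z ys ↭ z ∷ ys
  insertAt-↭ zero    z ys       = ↭-refl
  insertAt-↭ (suc i) z []       = ↭-refl
  insertAt-↭ (suc i) z (y ∷ ys) = ↭-trans (↭-prep y (insertAt-↭ i z ys)) (↭-swap y z ↭-refl)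

  fresh?-insertAt-self : ∀ i z ys → fresh? z (insertAt i z ys) ≡ false
  fresh?-insertAt-self i z ys = trans (fresh?-↭ z (insertAt-↭ i z ys))
    (dec-false (All.all? (z ≢?_) (z ∷ ys)) λ { (z≢z ∷ _) → z≢z refl })

  fresh?-insertAt : ∀ {x z} → x ≢ z → ∀ i ys → fresh? x (insertAt i z ys) ≡ fresh? x ys
  fresh?-insertAt {x} {z} x≢z i ys = trans (fresh?-↭ x (insertAt-↭ i z ys))
    (cong (_∧ fresh? x ys) (dec-true (¬? (x ≟ z)) x≢z))

  startingWith-insertAt-self : ∀ z (g : List A → ℕ) i ys → startingWith z g (insertAt i z ys) ≡ 0
  startingWith-insertAt-self z g i ys = cong (g (z ∷ insertAt i z ys) when_) (fresh?-insertAt-self i z ys)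

  startingWith-insertAt : ∀ {x z} → x ≢ z → ∀ {g h : List A → ℕ} → (∀ i ys → g (insertAt i z ys) ≡ h ys) →
    ∀ i ys → startingWith x g (insertAt i z ys) ≡ startingWith x h ys
  startingWith-insertAt x≢z g≗h i ys = cong₂ _when_ (g≗h (suc i) (_ ∷ ys)) (fresh?-insertAt x≢z i ys)

  ∑-distinct-map : ∀ {τ : A → A} → Injective _≡_ _≡_ τ → ∀ D n (g : List A → ℕ) →
    ∑-distinct (map τ D) n g ≡ ∑-distinct D n (λ xs → g (map τ xs))
  ∑-distinct-map τ-inj D zero    g = refl
  ∑-distinct-map {τ} τ-inj D (suc n) g = begin
    ∑-distinct (map τ D) (suc n) g
      ≡⟨ ∑-distinct-suc (map τ D) n g ⟩
    ∑ (map τ D) (λ x → ∑-distinct (map τ D) n (startingWith x g))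
      ≡⟨ ∑-map τ D _ ⟩
    ∑ D (λ y → ∑-distinct (map τ D) n (startingWith (τ y) g))
      ≡⟨ ∑-cong D (λ {y} _ → trans (∑-distinct-map τ-inj D n _) (∑-distinct-cong D n λ {ys} _ _ →
           cong (g (τ y ∷ map τ ys) when_) (fresh?-map τ-inj y ys))) ⟩
    ∑ D (λ y → ∑-distinct D n (startingWith y (λ xs → g (map τ xs))))
      ≡⟨ ∑-distinct-suc D n (λ xs → g (map τ xs)) ⟨
    ∑-distinct D (suc n) (λ xs → g (map τ xs)) ∎
    where open ≡-Reasoning

  ∑-distinct-∷-avoiding : ∀ {z D} → z ∉ D → ∀ n (g : List A → ℕ) → (∀ i ys → g (insertAt i z ys) ≡ 0) →
    ∑-distinct (z ∷ D) n g ≡ ∑-distinct D n g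
  ∑-distinct-∷-avoiding z∉D zero    g vanish = refl
  ∑-distinct-∷-avoiding {z} {D} z∉D (suc n) g vanish = begin
    ∑-distinct (z ∷ D) (suc n) g
      ≡⟨ ∑-distinct-suc (z ∷ D) n g ⟩
    ∑-distinct (z ∷ D) n (startingWith z g) ℕ.+ ∑ D (λ x → ∑-distinct (z ∷ D) n (startingWith x g))
      ≡⟨ cong₂ ℕ._+_ none-start-with-z (∑-cong D λ {x} _ →
           ∑-distinct-∷-avoiding z∉D n (startingWith x g) λ i ys →
             trans (cong (_when _) (vanish (suc i) (x ∷ ys))) (0-when _)) ⟩
    ∑ D (λ x → ∑-distinct D n (startingWith x g))
      ≡⟨ ∑-distinct-suc D n g ⟨
    ∑-distinct D (suc n) g ∎
    where
    open ≡-Reasoning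
    none-start-with-z : ∑-distinct (z ∷ D) n (startingWith z g) ≡ 0
    none-start-with-z = trans (∑-distinct-cong (z ∷ D) n λ {ys} _ _ →
                     trans (cong (_when fresh? z ys) (vanish 0 ys)) (0-when _))
                  (∑-distinct-zero (z ∷ D) n)

  -- A distinct n-tuple over z ∷ D either avoids z or is insertAt i z ys for a distinct
  -- (n - 1)-tuple ys over D and one of n positions i.
  ∑-distinct-∷ : ∀ {z D} → z ∉ D → ∀ n (g h : List A → ℕ) → (∀ i ys → g (insertAt i z ys) ≡ h ys) →
    ∑-distinct (z ∷ D) n g ≡ ∑-distinct D n g ℕ.+ n ℕ.* ∑-distinct D (n ∸ 1) h
  ∑-distinct-∷ z∉D zero    g h g≗h = sym (ℕ.+-identityʳ _)
  ∑-distinct-∷ {z} {D} z∉D (suc m) g h g≗h = begin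
    ∑-distinct (z ∷ D) (suc m) g
      ≡⟨ ∑-distinct-suc (z ∷ D) m g ⟩
    ∑-distinct (z ∷ D) m (startingWith z g) ℕ.+ ∑ D (λ x → ∑-distinct (z ∷ D) m (startingWith x g))
      ≡⟨ cong₂ ℕ._+_ starting-with-z (∑-cong D starting-with-x) ⟩
    ∑h ℕ.+ ∑ D (λ x → ∑-distinct D m (startingWith x g) ℕ.+ m ℕ.* ∑-distinct D (m ∸ 1) (startingWith x h))
      ≡⟨ cong (∑h ℕ.+_) (trans (∑-+ D _ _)
           (cong₂ ℕ._+_ (sym (∑-distinct-suc D m g)) (trans (sym (*-∑ D m _)) (collect m)))) ⟩
    ∑h ℕ.+ (∑-distinct D (suc m) g ℕ.+ m ℕ.* ∑h)
      ≡⟨ x∙yz≈y∙xz ∑h (∑-distinct D (suc m) g) (m ℕ.* ∑h) ⟩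
    ∑-distinct D (suc m) g ℕ.+ suc m ℕ.* ∑h ∎
    where
    open ≡-Reasoning
    ∑h : ℕ
    ∑h = ∑-distinct D m h
    starting-with-z : ∑-distinct (z ∷ D) m (startingWith z g) ≡ ∑h
    starting-with-z = begin
      ∑-distinct (z ∷ D) m (startingWith z g)
        ≡⟨ ∑-distinct-∷-avoiding z∉D m (startingWith z g) (startingWith-insertAt-self z g) ⟩
      ∑-distinct D m (startingWith z g)
        ≡⟨ ∑-distinct-cong D m (λ {ys} ys∈D _ →
             trans (cong (g (z ∷ ys) when_) (fresh?-∉ z∉D ys∈D)) (g≗h 0 ys)) ⟩
      ∑h ∎
    starting-with-x : ∀ {x} → x ∈ D → ∑-distinct (z ∷ D) m (startingWith x g) ≡
      ∑-distinct D m (startingWith x g) ℕ.+ m ℕ.* ∑-distinct D (m ∸ 1) (startingWith x h)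
    starting-with-x {x} x∈D = ∑-distinct-∷ z∉D m (startingWith x g) (startingWith x h)
      (startingWith-insertAt (λ { refl → z∉D x∈D }) {g} g≗h)
    collect : ∀ m → m ℕ.* ∑ D (λ x → ∑-distinct D (m ∸ 1) (startingWith x h)) ≡ m ℕ.* ∑-distinct D m h
    collect zero     = refl
    collect (suc m′) = cong (suc m′ ℕ.*_) (sym (∑-distinct-suc D m′ h))

module FieldArithmetic (F : FiniteField) where

  open FiniteField F hiding (tuples)
    renaming (_+_ to infixl 6 _+_; _*_ to infixl 7 _*_; -_ to infix 8 -_; _≟_ to infix 4 _≟_)
  open DistinctTuples _≟_ using (insertAt)

  commutativeRing : CommutativeRing 0ℓ 0ℓ
  commutativeRing = record { isCommutativeRing = isCommutativeRing }

  private
    module R = CommutativeRing commutativeRing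
  open import Algebra.Properties.AbelianGroup R.+-abelianGroup
    using (//-rightDividesˡ) renaming (∙-cancelˡ to +-cancelˡ; ∙-cancelʳ to +-cancelʳ)
  open import Algebra.Properties.CommutativeSemigroup R.+-commutativeSemigroup
    using () renaming (interchange to +-interchange; x∙yz≈y∙xz to +-exchange)
  open import Algebra.Properties.Semiring.Mult R.semiring using (×1-homo-*) renaming (_×_ to _·_)
  open ≡-Reasoning

  natCast≡·1# : ∀ n → natCast n ≡ n · 1#
  natCast≡·1# zero    = refl
  natCast≡·1# (suc n) = cong (1# +_) (natCast≡·1# n)

  natCast-* : ∀ m n → natCast (m ℕ.* n) ≡ natCast m * natCast n
  natCast-* m n = begin
    natCast (m ℕ.* n)      ≡⟨ natCast≡·1# (m ℕ.* n) ⟩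
    (m ℕ.* n) · 1#         ≡⟨ ×1-homo-* m n ⟩
    (m · 1#) * (n · 1#)    ≡⟨ cong₂ _*_ (natCast≡·1# m) (natCast≡·1# n) ⟨
    natCast m * natCast n  ∎

  natCast-suc-* : ∀ n c → natCast (suc n) * c ≡ c + natCast n * c
  natCast-suc-* n c = trans (R.distribʳ c 1# (natCast n)) (cong (_+ natCast n * c) (R.*-identityˡ c))

  sumF-map-+ : ∀ c ys → sumF (map (_+ c) ys) ≡ sumF ys + natCast (length ys) * c
  sumF-map-+ c []       = sym (trans (R.+-identityˡ _) (R.zeroˡ c))
  sumF-map-+ c (y ∷ ys) = begin
    (y + c) + sumF (map (_+ c) ys)                ≡⟨ cong ((y + c) +_) (sumF-map-+ c ys) ⟩
    (y + c) + (sumF ys + natCast (length ys) * c) ≡⟨ +-interchange y c (sumF ys) _ ⟩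
    (y + sumF ys) + (c + natCast (length ys) * c) ≡⟨ cong (y + sumF ys +_) (natCast-suc-* (length ys) c) ⟨
    (y + sumF ys) + natCast (suc (length ys)) * c ∎

  sumF-∷-map-+ : ∀ c ys → sumF (c ∷ map (_+ c) ys) ≡ sumF ys + natCast (suc (length ys)) * c
  sumF-∷-map-+ c ys = begin
    c + sumF (map (_+ c) ys)                  ≡⟨ cong (c +_) (sumF-map-+ c ys) ⟩
    c + (sumF ys + natCast (length ys) * c)   ≡⟨ +-exchange c (sumF ys) _ ⟩
    sumF ys + (c + natCast (length ys) * c)   ≡⟨ cong (sumF ys +_) (natCast-suc-* (length ys) c) ⟨
    sumF ys + natCast (suc (length ys)) * c   ∎

  sumF-insertAt-0# : ∀ i ys → sumF (insertAt i 0# ys) ≡ sumF ys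
  sumF-insertAt-0# zero    ys       = R.+-identityˡ (sumF ys)
  sumF-insertAt-0# (suc i) []       = R.+-identityˡ 0#
  sumF-insertAt-0# (suc i) (y ∷ ys) = cong (y +_) (sumF-insertAt-0# i ys)

  +-injectiveʳ : ∀ c → Injective _≡_ _≡_ (_+ c)
  +-injectiveʳ c {x} {y} = +-cancelʳ c x y

  z-c+c≡z : ∀ z c → (z + - c) + c ≡ z
  z-c+c≡z z c = //-rightDividesˡ c z

  *-cancelˡ-nonzero : ∀ {k x y} → k ≢ 0# → k * x ≡ k * y → x ≡ y
  *-cancelˡ-nonzero {k} {x} {y} k≢0 kx≡ky with k⁻¹ , kk⁻¹≡1 ← inverse k k≢0 = begin
    x              ≡⟨ R.*-identityˡ x ⟨
    1# * x         ≡⟨ cong (_* x) (trans (sym kk⁻¹≡1) (R.*-comm k k⁻¹)) ⟩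
    k⁻¹ * k * x    ≡⟨ R.*-assoc k⁻¹ k x ⟩
    k⁻¹ * (k * x)  ≡⟨ cong (k⁻¹ *_) kx≡ky ⟩
    k⁻¹ * (k * y)  ≡⟨ R.*-assoc k⁻¹ k y ⟨
    k⁻¹ * k * y    ≡⟨ cong (_* y) (trans (R.*-comm k⁻¹ k) kk⁻¹≡1) ⟩
    1# * y         ≡⟨ R.*-identityˡ y ⟩
    y              ∎

  affine-solvable : ∀ {k} → k ≢ 0# → ∀ s b → ∃ λ x → s + k * x ≡ b
  affine-solvable {k} k≢0 s b with k⁻¹ , kk⁻¹≡1 ← inverse k k≢0 = k⁻¹ * (b + - s) , (begin
    s + k * (k⁻¹ * (b + - s))  ≡⟨ cong (s +_) (R.*-assoc k k⁻¹ _) ⟨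
    s + k * k⁻¹ * (b + - s)    ≡⟨ cong (λ t → s + t * (b + - s)) kk⁻¹≡1 ⟩
    s + 1# * (b + - s)         ≡⟨ cong (s +_) (R.*-identityˡ _) ⟩
    s + (b + - s)              ≡⟨ R.+-comm s _ ⟩
    b + - s + s                ≡⟨ z-c+c≡z b s ⟩
    b                          ∎)

  affine-injective : ∀ {k} → k ≢ 0# → ∀ s {x y} → s + k * x ≡ s + k * y → x ≡ y
  affine-injective k≢0 s eq = *-cancelˡ-nonzero k≢0 (+-cancelˡ s _ _ eq)

module Counting (F : FiniteField) where

  open FiniteField F hiding (tuples)
    renaming (_+_ to infixl 6 _+_; _*_ to infixl 7 _*_; -_ to infix 8 -_; _≟_ to infix 4 _≟_)
  open DistinctTuples _≟_
  open FieldArithmetic F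
  private
    module R = CommutativeRing commutativeRing

  tuples≡ : ∀ D n → FiniteField.tuples F D n ≡ tuples D n
  tuples≡ D zero    = refl
  tuples≡ D (suc n) = cong (λ T → concatMap (λ x → map (x ∷_) T) D) (tuples≡ D n)

  elements-unique : Unique elements
  elements-unique = Unique.map⁺ (proj₁ enum-bij) (Unique.allFin⁺ q)

  ∈-elements : ∀ x → x ∈ elements
  ∈-elements x with i , enum≡ ← proj₂ enum-bij x = subst (_∈ elements) (enum≡ refl) (∈-map⁺ enum (∈-allFin i))

  length-elements : length elements ≡ q
  length-elements = trans (List.length-map enum (allFin q)) (List.length-tabulate id)

  elements-↭ : ∀ {L} → Unique L → (∀ x → x ∈ L) → elements ↭ L
  elements-↭ L-unique ∈L = ∼bag⇒↭ (unique∧set⇒bag elements-unique L-unique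
    (λ {x} → mk⇔ (λ _ → ∈L x) (λ _ → ∈-elements x)))

  nonzeros : List Carrier
  nonzeros = filter nonzero? elements

  ∈-nonzeros⁻ : ∀ {x} → x ∈ nonzeros → x ≢ 0#
  ∈-nonzeros⁻ x∈ = proj₂ (∈-filter⁻ nonzero? {xs = elements} x∈)

  ∉-map-+-nonzeros : ∀ c → c ∉ map (_+ c) nonzeros
  ∉-map-+-nonzeros c c∈ with y , y∈ , c≡y+c ← ∈-map⁻ (_+ c) c∈ =
    ∈-nonzeros⁻ y∈ (+-injectiveʳ c (trans (sym c≡y+c) (sym (R.+-identityˡ c))))

  -- Every z ≠ c is (z - c) + c with z - c ≠ 0.
  elements-↭-∷-map-+ : ∀ c → elements ↭ c ∷ map (_+ c) nonzeros
  elements-↭-∷-map-+ c = elements-↭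
    (All.tabulate (λ c′∈ c≡c′ → ∉-map-+-nonzeros c (subst (_∈ _) (sym c≡c′) c′∈))
      ∷ Unique.map⁺ (+-injectiveʳ c) (Unique.filter⁺ nonzero? elements-unique))
    complete
    where
    complete : ∀ z → z ∈ c ∷ map (_+ c) nonzeros
    complete z with z ≟ c
    ... | yes z≡c = here z≡c
    ... | no  z≢c = there (subst (_∈ map (_+ c) nonzeros) (z-c+c≡z z c)
      (∈-map⁺ (_+ c) (∈-filter⁺ nonzero? (∈-elements _)
        λ z-c≡0 → z≢c (trans (sym (z-c+c≡z z c)) (trans (cong (_+ c) z-c≡0) (R.+-identityˡ c))))))

  elements-↭-0#∷nonzeros : elements ↭ 0# ∷ nonzeros
  elements-↭-0#∷nonzeros = subst (λ L → elements ↭ 0# ∷ L)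
    (trans (List.map-cong R.+-identityʳ nonzeros) (List.map-id nonzeros)) (elements-↭-∷-map-+ 0#)

  sumIs : Carrier → List Carrier → ℕ
  sumIs b xs = 𝟙 (does (sumF xs ≟ b))

  M≡∑-distinct : ∀ n b → M nonzero? n b ≡ ∑-distinct nonzeros n (sumIs b)
  M≡∑-distinct n b = begin
    M nonzero? n b
      ≡⟨ length-filter _ (FiniteField.tuples F nonzeros n) ⟩
    ∑ (FiniteField.tuples F nonzeros n) (λ xs → 𝟙 (distinct? xs ∧ does (sumF xs ≟ b)))
      ≡⟨ cong (λ T → ∑ T (λ xs → 𝟙 (distinct? xs ∧ does (sumF xs ≟ b)))) (tuples≡ nonzeros n) ⟩
    ∑ (tuples nonzeros n) (λ xs → 𝟙 (distinct? xs ∧ does (sumF xs ≟ b)))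
      ≡⟨ ∑-cong (tuples nonzeros n) (λ {xs} _ → when-∧ 1 (distinct? xs) (does (sumF xs ≟ b))) ⟩
    ∑-distinct nonzeros n (sumIs b) ∎
    where open ≡-Reasoning

  ∑-distinct-elements-via-nonzeros : ∀ k b →
    ∑-distinct elements k (sumIs b) ≡ M nonzero? k b ℕ.+ k ℕ.* M nonzero? (k ∸ 1) b
  ∑-distinct-elements-via-nonzeros k b = begin
    ∑-distinct elements k (sumIs b)
      ≡⟨ ∑-distinct-↭ elements-↭-0#∷nonzeros k (sumIs b) ⟩
    ∑-distinct (0# ∷ nonzeros) k (sumIs b)
      ≡⟨ ∑-distinct-∷ (λ 0∈ → ∈-nonzeros⁻ 0∈ refl) k (sumIs b) (sumIs b)
           (λ i ys → cong (λ s → 𝟙 (does (s ≟ b))) (sumF-insertAt-0# i ys)) ⟩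
    ∑-distinct nonzeros k (sumIs b) ℕ.+ k ℕ.* ∑-distinct nonzeros (k ∸ 1) (sumIs b)
      ≡⟨ cong₂ (λ u v → u ℕ.+ k ℕ.* v) (M≡∑-distinct k b) (M≡∑-distinct (k ∸ 1) b) ⟨
    M nonzero? k b ℕ.+ k ℕ.* M nonzero? (k ∸ 1) b ∎
    where open ≡-Reasoning

  ∑-distinct-elements-by-head : ∀ m (g : List Carrier → ℕ) →
    ∑-distinct elements (suc m) g ≡ ∑ elements (λ c → ∑-distinct nonzeros m (λ ys → g (c ∷ map (_+ c) ys)))
  ∑-distinct-elements-by-head m g = trans (∑-distinct-suc elements m g) (∑-cong elements λ {c} _ → begin
    ∑-distinct elements m (startingWith c g)
      ≡⟨ ∑-distinct-↭ (elements-↭-∷-map-+ c) m (startingWith c g) ⟩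
    ∑-distinct (c ∷ map (_+ c) nonzeros) m (startingWith c g)
      ≡⟨ ∑-distinct-∷-avoiding (∉-map-+-nonzeros c) m (startingWith c g)
           (startingWith-insertAt-self c g) ⟩
    ∑-distinct (map (_+ c) nonzeros) m (startingWith c g)
      ≡⟨ ∑-distinct-map (+-injectiveʳ c) nonzeros m (startingWith c g) ⟩
    ∑-distinct nonzeros m (λ ys → startingWith c g (map (_+ c) ys))
      ≡⟨ ∑-distinct-cong nonzeros m (λ {ys} ys∈ _ → cong (g (c ∷ map (_+ c) ys) when_)
           (fresh?-∉ (∉-map-+-nonzeros c) (All.map⁺ (All.map (∈-map⁺ (_+ c)) ys∈)))) ⟩
    ∑-distinct nonzeros m (λ ys → g (c ∷ map (_+ c) ys)) ∎)
    where open ≡-Reasoning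

  ∑-distinct-elements-sumIs-by-head : ∀ m b → ∑-distinct elements (suc m) (sumIs b) ≡
    ∑-distinct nonzeros m (λ ys → ∑ elements (λ c → 𝟙 (does (sumF ys + natCast (suc m) * c ≟ b))))
  ∑-distinct-elements-sumIs-by-head m b = begin
    ∑-distinct elements (suc m) (sumIs b)
      ≡⟨ ∑-distinct-elements-by-head m (sumIs b) ⟩
    ∑ elements (λ c → ∑-distinct nonzeros m (λ ys → sumIs b (c ∷ map (_+ c) ys)))
      ≡⟨ ∑-distinct-∑ nonzeros m elements (λ c ys → sumIs b (c ∷ map (_+ c) ys)) ⟨
    ∑-distinct nonzeros m (λ ys → ∑ elements (λ c → sumIs b (c ∷ map (_+ c) ys)))
      ≡⟨ ∑-distinct-cong nonzeros m (λ {ys} _ len → ∑-cong elements λ {c} _ →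
           cong (λ s → 𝟙 (does (s ≟ b)))
             (trans (sumF-∷-map-+ c ys) (cong (λ l → sumF ys + natCast (suc l) * c) len))) ⟩
    ∑-distinct nonzeros m (λ ys → ∑ elements (λ c → 𝟙 (does (sumF ys + natCast (suc m) * c ≟ b)))) ∎
    where open ≡-Reasoning

  count-affine-unit : ∀ {k} → k ≢ 0# → ∀ s b → ∑ elements (λ c → 𝟙 (does (s + k * c ≟ b))) ≡ 1
  count-affine-unit k≢0 s b with x₀ , x₀-solves ← affine-solvable k≢0 s b =
    trans (∑-supported _ elements-unique (∈-elements x₀) λ c≢x₀ →
             cong 𝟙 (dec-false (_ ≟ b) λ c-solves →
               c≢x₀ (affine-injective k≢0 s (trans c-solves (sym x₀-solves)))))
          (cong 𝟙 (dec-true (_ ≟ b) x₀-solves))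

  count-affine-zero : ∀ {k} → k ≡ 0# → ∀ s b →
    ∑ elements (λ c → 𝟙 (does (s + k * c ≟ b))) ≡ q ℕ.* 𝟙 (does (s ≟ b))
  count-affine-zero refl s b = begin
    ∑ elements (λ c → 𝟙 (does (s + 0# * c ≟ b)))
      ≡⟨ ∑-cong elements (λ {c} _ → cong (λ t → 𝟙 (does (t ≟ b)))
           (trans (cong (s +_) (R.zeroˡ c)) (R.+-identityʳ s))) ⟩
    ∑ elements (λ _ → 𝟙 (does (s ≟ b)))
      ≡⟨ ∑-const elements _ ⟩
    length elements ℕ.* 𝟙 (does (s ≟ b))
      ≡⟨ cong (ℕ._* 𝟙 (does (s ≟ b))) length-elements ⟩
    q ℕ.* 𝟙 (does (s ≟ b)) ∎
    where open ≡-Reasoning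

  M-recurrence-unit : ∀ m → natCast (suc m) ≢ 0# → ∀ b b′ →
    M nonzero? (suc m) b ℕ.+ suc m ℕ.* M nonzero? m b ≡ M nonzero? (suc m) b′ ℕ.+ suc m ℕ.* M nonzero? m b′
  M-recurrence-unit m k≢0 b b′ = begin
    M nonzero? (suc m) b ℕ.+ suc m ℕ.* M nonzero? m b    ≡⟨ ∑-distinct-elements-via-nonzeros (suc m) b ⟨
    ∑-distinct elements (suc m) (sumIs b)                ≡⟨ independent b ⟩
    ∑-distinct nonzeros m (λ _ → 1)                      ≡⟨ independent b′ ⟨
    ∑-distinct elements (suc m) (sumIs b′)               ≡⟨ ∑-distinct-elements-via-nonzeros (suc m) b′ ⟩
    M nonzero? (suc m) b′ ℕ.+ suc m ℕ.* M nonzero? m b′  ∎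
    where
    open ≡-Reasoning
    independent : ∀ b → ∑-distinct elements (suc m) (sumIs b) ≡ ∑-distinct nonzeros m (λ _ → 1)
    independent b = trans (∑-distinct-elements-sumIs-by-head m b)
      (∑-distinct-cong nonzeros m λ {ys} _ _ → count-affine-unit k≢0 (sumF ys) b)

  M-recurrence-zero : ∀ m → natCast (suc m) ≡ 0# → ∀ b →
    M nonzero? (suc m) b ℕ.+ suc m ℕ.* M nonzero? m b ≡ q ℕ.* M nonzero? m b
  M-recurrence-zero m k≡0 b = begin
    M nonzero? (suc m) b ℕ.+ suc m ℕ.* M nonzero? m b  ≡⟨ ∑-distinct-elements-via-nonzeros (suc m) b ⟨
    ∑-distinct elements (suc m) (sumIs b)              ≡⟨ ∑-distinct-elements-sumIs-by-head m b ⟩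
    ∑-distinct nonzeros m (λ ys → ∑ elements (λ c → 𝟙 (does (sumF ys + natCast (suc m) * c ≟ b))))
      ≡⟨ ∑-distinct-cong nonzeros m (λ {ys} _ _ → count-affine-zero k≡0 (sumF ys) b) ⟩
    ∑-distinct nonzeros m (λ ys → q ℕ.* sumIs b ys)    ≡⟨ *-∑-distinct nonzeros m q (sumIs b) ⟨
    q ℕ.* ∑-distinct nonzeros m (sumIs b)              ≡⟨ cong (q ℕ.*_) (M≡∑-distinct m b) ⟨
    q ℕ.* M nonzero? m b                               ∎
    where open ≡-Reasoning

module Characteristic (F : FiniteField) {p} (char : FiniteField.IsCharacteristic F p) where

  open FiniteField F renaming (_+_ to infixl 6 _+_; _*_ to infixl 7 _*_)
  open FieldArithmetic F
  private
    module R = CommutativeRing commutativeRing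

  natCast-*-zero : ∀ m {n} → natCast n ≡ 0# → natCast (m ℕ.* n) ≡ 0#
  natCast-*-zero m {n} n≡0 = trans (natCast-* m n) (trans (cong (natCast m *_) n≡0) (R.zeroʳ _))

  natCast-suc≢0 : ∀ {a b} → natCast a ≡ 0# → natCast b ≡ 0# → suc a ≢ b
  natCast-suc≢0 {a} a≡0 b≡0 refl = 0≢1 (begin
    0#           ≡⟨ b≡0 ⟨
    1# + natCast a ≡⟨ cong (1# +_) a≡0 ⟩
    1# + 0#      ≡⟨ R.+-identityʳ 1# ⟩
    1#           ∎)
    where open ≡-Reasoning

  natCast-∣ : ∀ {k} → p ∣ k → natCast k ≡ 0#
  natCast-∣ (divides t refl) = natCast-*-zero t (proj₂ char)

  p∤1 : ¬ p ∣ 1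
  p∤1 p∣1 = natCast-suc≢0 {0} refl (natCast-∣ p∣1) refl

  -- By Bézout, 1 + (a multiple of one of p, k) is a multiple of the other.
  natCast-∤ : ∀ {k} → ¬ p ∣ k → natCast k ≢ 0#
  natCast-∤ {k} p∤k k≡0 with coprime-Bézout coprime
    where
    coprime : Coprime p k
    coprime (i∣p , i∣k) with prime⇒irreducible (proj₁ char) i∣p
    ... | inj₁ i≡1 = i≡1
    ... | inj₂ refl = ⊥-elim (p∤k i∣k)
  ... | Bézout.+- x y 1+yk≡xp = natCast-suc≢0 (natCast-*-zero y k≡0) (natCast-*-zero x (proj₂ char)) 1+yk≡xp
  ... | Bézout.-+ x y 1+xp≡yk = natCast-suc≢0 (natCast-*-zero x (proj₂ char)) (natCast-*-zero y k≡0) 1+xp≡yk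

module Recurrence (F : FiniteField) {p} (char : FiniteField.IsCharacteristic F p) where

  open FiniteField F using (d; q; M; nonzero?; 0#; 1#; 0≢1; _≟_)
  open Counting F using (M≡∑-distinct; M-recurrence-unit; M-recurrence-zero)
  open Characteristic F char using (natCast-∣; natCast-∤)
  open import Data.Integer using (+_)

  d≡M-M : ∀ j → d j ≡ + M nonzero? j 1# ℤ.- + M nonzero? j 0#
  d≡M-M zero
    rewrite M≡∑-distinct 0 1# | M≡∑-distinct 0 0# | dec-false (0# ≟ 1#) 0≢1 | dec-true (0# ≟ 0#) refl = refl
  d≡M-M (suc j) = refl

  d-suc-∤ : ∀ m → ¬ p ∣ suc m → d (suc m) ≡ ℤ.- + suc m ℤ.* d m
  d-suc-∤ m p∤ rewrite d≡M-M m =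
    a-c≡-k[x-y] (M nonzero? (suc m) 1#) (M nonzero? (suc m) 0#) (suc m) (M nonzero? m 1#) (M nonzero? m 0#)
      (M-recurrence-unit m (natCast-∤ p∤) 1# 0#)

  d-suc-∣ : ∀ m → p ∣ suc m → d (suc m) ≡ (+ q ℤ.- + suc m) ℤ.* d m
  d-suc-∣ m p∣ rewrite d≡M-M m =
    a-c≡[q-k][x-y] (M nonzero? (suc m) 1#) (M nonzero? (suc m) 0#) (suc m) (M nonzero? m 1#) (M nonzero? m 0#) q
      (M-recurrence-zero m (natCast-∣ p∣) 1#) (M-recurrence-zero m (natCast-∣ p∣) 0#)

lemma2p4 : (F : FiniteField) (p : ℕ) → FiniteField.IsCharacteristic F p →
    let open FiniteField F in
    (d 1 ≡ ℤ.+ 1) ×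
    (∀ k → 2 ≤ k → k ≤ q ℕ.∸ 1 →
      (¬ (p ∣ k) → d k ≡ ℤ.- (ℤ.+ k) ℤ.* d (k ℕ.∸ 1)) ×
      (p ∣ k → d k ≡ (ℤ.+ q ℤ.- ℤ.+ k) ℤ.* d (k ℕ.∸ 1)))
-- The recurrences hold for every k ≥ 1.
lemma2p4 F p char = d-suc-∤ 0 p∤1 , λ where
    (suc m) _ _ → d-suc-∤ m , d-suc-∣ m
  where
  open Recurrence F char
  open Characteristic F char using (p∤1)
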